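{- Let $n\ge 1$ be an integer and let $\mathcal{SG}_n$ be the set of subdiagonal general lattice paths from $(0,0)$ to $(n,n)$. Then the parameter "active set" restricted to $\mathcal{SG}_n$ is uniformly distributed over all subsets of $[n-1]=\{1,2,\ldots,n-1\}$: for every subset $S\subseteq[n-1]$, the number of paths $\pi\in\mathcal{SG}_n$ whose active set equals $S$ is the same (i.e. independent of $S$).
   Context: A general lattice path is a finite sequence of steps, each step lying in $\mathbb{N}\times\mathbb{N}\setminus\{(0,0)\}$ (i.e. $(i,j)$ with $i,j$ nonnegative integers not both $0$). A path starting at $(0,0)$ has as vertices $(0,0)$ and the successive partial sums of its steps; consecutive vertices are joined by line segments. A subpath of a path $\pi$ is a subsequence of consecutive steps of $\pi$ (so it starts at some vertex of $\pi$ and ends at a later vertex); it is nonempty if it has at least one step. A path is balanced if its terminal vertex lies on the line of slope $1$ through its initial vertex. A path is subdiagonal if it never rises above the line of slope $1$ through its initial vertex, and superdiagonal if it never falls below the line of slope $1$ through its initial vertex. Thus $\mathcal{SG}_n$ consists of the general lattice paths from $(0,0)$ to $(n,n)$ never rising above $y=x$. For such a path $\pi$ and $1\le k\le n-1$, the vertical line $x=k$ is active for $\pi$ if it contains a vertex $V$ of $\pi$ such that (i) $V$ lies on the line $y=x$, or (ii) $V$ lies strictly below $y=x$ and $V$ is the initial vertex of a nonempty balanced subdiagonal subpath of $\pi$, or (iii) $V$ lies strictly above $y=x$ and $V$ is the terminal vertex of a nonempty balanced superdiagonal subpath of $\pi$. The active set of $\pi$ is $\{k\in[n-1]: x=k \text{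 is active for } \pi\}$. -}

module Defs where

open import Data.Nat using (ℕ; zero; suc; _+_; _≤_; _<_; _∸_)
open import Data.Product using (Σ; ∃; ∃-syntax; _×_; _,_; proj₁; proj₂)
open import Data.Sum using (_⊎_)
open import Data.List using (List; length; take; map)
open import Data.Nat.ListAction using (sum)
open import Data.List.Relation.Unary.All using (All)
open import Data.Fin using (Fin; toℕ)
open import Data.Fin.Subset using (Subset; _∈_)
open import Relation.Nullary using (¬_)
open import Relation.Binary.PropositionalEquality using (_≡_)
open import Function.Bundles using (_⇔_)

-- A step is a pair (i , j) of naturals; the condition (i , j) ≠ (0 , 0)
-- is imposed in `IsSG`.
Step : Set
Step = ℕ × ℕ

-- A general lattice path starting at (0,0), given by its list of steps.
Path : Set
Path = List Step

-- Coordinates of the k-th vertex (k = 0 .. length π) of π: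
-- vertex 0 is (0,0), vertex k is the sum of the first k steps.
vx : Path → ℕ → ℕ
vx π k = sum (map proj₁ (take k π))

vy : Path → ℕ → ℕ
vy π k = sum (map proj₂ (take k π))

IsSG : ℕ → Path → Set
IsSG n π =
  All (λ s → ¬ (s ≡ (0 , 0))) π
  × vx π (length π) ≡ n × vy π (length π) ≡ n
  × (∀ i → i ≤ length π → vy π i ≤ vx π i)

-- The subpath of π from vertex i to vertex j (i < j) is balanced:
-- V_j − V_i lies on the line of slope 1, i.e. xj − xi = yj − yi.
Balanced : Path → ℕ → ℕ → Set
Balanced π i j = vx π j + vy π i ≡ vy π j + vx π i

-- Vertex l is weakly below (resp. above) the line of slope 1 through vertex i.
BelowFrom : Path → ℕ → ℕ → Set
BelowFrom π i l = vy π l + vx π i ≤ vx π l + vy π i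

AboveFrom : Path → ℕ → ℕ → Set
AboveFrom π i l = vx π l + vy π i ≤ vy π l + vx π i

StartsBalSub : Path → ℕ → Set
StartsBalSub π i =
  ∃[ j ] (i < j × j ≤ length π × Balanced π i j
          × (∀ l → i ≤ l → l ≤ j → BelowFrom π i l))

EndsBalSuper : Path → ℕ → Set
EndsBalSuper π i =
  ∃[ j ] (j < i × Balanced π j i
          × (∀ l → j ≤ l → l ≤ i → AboveFrom π j l))

Active : Path → ℕ → Set
Active π k =
  ∃[ i ] (i ≤ length π × vx π i ≡ k ×
    ( vy π i ≡ vx π i
    ⊎ (vy π i < vx π i × StartsBalSub π i)
    ⊎ (vx π i < vy π i × EndsBalSuper π i)))

-- Subsets of [n-1] = {1,…,n-1} are encoded as `Subset (n ∸ 1)`,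
-- where index i : Fin (n ∸ 1) stands for the element toℕ i + 1.
ActiveSetIs : (n : ℕ) → Path → Subset (n ∸ 1) → Set
ActiveSetIs n π S = ∀ (i : Fin (n ∸ 1)) → Active π (suc (toℕ i)) ⇔ (i ∈ S)

WithActive : (n : ℕ) → Subset (n ∸ 1) → Path → Set
WithActive n S π = IsSG n π × ActiveSetIs n π S

-- The sets {π ∈ SG_n | act(π) = S} and {π ∈ SG_n | act(π) = T}
-- have the same cardinality: there is a bijection between them.
SameCount : (n : ℕ) → Subset (n ∸ 1) → Subset (n ∸ 1) → Set
SameCount n S T =
  Σ (Path → Path) λ f → Σ (Path → Path) λ g →
      (∀ π → WithActive n S π → WithActive n T (f π))
    × (∀ π → WithActive n T π → WithActive n S (g π))
    × (∀ π → WithActive n S π → g (f π) ≡ π)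
    × (∀ π → WithActive n T π → f (g π) ≡ π)

{-# OPTIONS --safe #-}

-- Measure heights h = x − y below the diagonal. The line x = k is active exactly
-- when the last vertex W of the path on it starts a balanced subdiagonal subpath:
-- after W the path first comes back to height ≤ h(W) exactly at h(W).
-- Toggling line k is an involution that fixes the path left of the line and the
-- status of every other line. If the line is active and W is entered by the step
-- (a , r), move the r down-steps of that step onto the step on which the path
-- returns to h(W), and merge the remaining (a , 0) into the following step.
-- Otherwise let V be the last vertex with x ≤ k and P the point where a horizontal
-- step from V meets the line. If the path continuing from P first comes back to
-- height ≤ h(P) at height h(P) − r, move r down-steps of that step onto a new step
-- from V to P. Chaining toggles of single lines links any two active sets.

module Submission where

open import Defs
open import Data.Bool using (Bool; true; false; _∨_; not)
open import Data.Bool.Properties using (not-involutive; not-¬; ¬-not; ∨-zeroʳ) renaming (_≟_ to _≟ᵇ_)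
open import Data.Empty using (⊥-elim)
open import Function using (_∘_; id)
open import Function.Bundles using (_⇔_; mk⇔; Equivalence)
open import Function.Construct.Composition using (_⇔-∘_)
open import Function.Construct.Identity using (⇔-id)
open import Function.Construct.Symmetry using (⇔-sym)
open import Data.Sum.Function.Propositional using (_⊎-⇔_)
open import Data.Product.Function.NonDependent.Propositional using (_×-⇔_)
open import Data.Fin using (Fin; zero; suc; toℕ) renaming (_≟_ to _≟ᶠ_)
open import Data.Fin.Properties using (toℕ<n; toℕ-injective)
open import Data.Fin.Subset using (Subset; _∈_)
open import Data.Vec using (_∷_; []; lookup)
open import Data.Vec.Properties using ([]=⇒lookup; lookup⇒[]=)
open import Data.List using (List; []; _∷_; length)
open import Data.List.Relation.Unary.All using (All; []; _∷_)
open import Data.Nat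
open import Data.Nat.Properties
open import Algebra.Properties.CommutativeSemigroup +-commutativeSemigroup
  using (xy∙z≈xz∙y; xy∙z≈y∙xz; x∙yz≈y∙xz; interchange)
open import Data.Product using (∃₂; ∃-syntax; _×_; _,_; proj₁; proj₂)
open import Data.Sum using (_⊎_; inj₁; inj₂; map₂)
open import Relation.Binary using (tri<; tri≈; tri>)
open import Relation.Binary.PropositionalEquality
open import Relation.Binary.Construct.Closure.ReflexiveTransitive using (Star; ε; _◅_; _◅◅_; gmap; fold)
open import Relation.Nullary using (¬_; yes; no)

-- Heights and subdiagonal paths

-- A suffix of a path in SG_n is given by the height h of its first vertex. On paths
-- that are Subdiagonal the truncated subtraction in _▸_ never truncates.
infixl 6 _▸_

_▸_ : ℕ → Step → ℕ
h ▸ (i , j) = h + i ∸ j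

data Subdiagonal : ℕ → Path → Set where
  end  : Subdiagonal 0 []
  step : ∀ {h i j σ} → 0 < i + j → j ≤ h + i → Subdiagonal (h ▸ (i , j)) σ →
         Subdiagonal h ((i , j) ∷ σ)

width : Path → ℕ
width []            = 0
width ((i , _) ∷ σ) = i + width σ

Subdiagonal-[] : ∀ {h} → Subdiagonal h [] → h ≡ 0
Subdiagonal-[] end = refl

Subdiagonal-≢[] : ∀ {h σ} → 0 < h → Subdiagonal h σ → σ ≢ []
Subdiagonal-≢[] h>0 σ-sub refl = <-irrefl (sym (Subdiagonal-[] σ-sub)) h>0

-- First returns and active lines

-- hits h σ u: the first vertex of σ after its start (of height h) that has height ≤ u
-- has height exactly u; hitsFrom also counts the start. So hits h σ h says that the
-- start of σ begins a nonempty balanced subdiagonal subpath.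
mutual
  hits : ℕ → Path → ℕ → Bool
  hits h []      u = false
  hits h (s ∷ σ) u = hitsFrom (h ▸ s) σ u

  hitsFrom : ℕ → Path → ℕ → Bool
  hitsFrom ℓ σ u with <-cmp u ℓ
  ... | tri< _ _ _ = hits ℓ σ u
  ... | tri≈ _ _ _ = true
  ... | tri> _ _ _ = false

-- active h σ k: some vertex of σ other than its start, at abscissa k relative to the
-- start, begins a nonempty balanced subdiagonal subpath. activeAfter i ℓ σ is the same
-- for a path whose first step has width i and ends at height ℓ, followed by σ.
mutual
  active : ℕ → Path → ℕ → Bool
  active h []            k = false
  active h ((i , j) ∷ σ) k = activeAfter i (h ▸ (i , j)) σ k

  activeAfter : ℕ → ℕ → Path → ℕ → Bool
  activeAfter i ℓ σ k with <-cmp k i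
  ... | tri< _ _ _ = false
  ... | tri≈ _ _ _ = hits ℓ σ ℓ ∨ active ℓ σ 0
  ... | tri> _ _ _ = active ℓ σ (k ∸ i)

hitsFrom-< : ∀ {ℓ u} σ → u < ℓ → hitsFrom ℓ σ u ≡ hits ℓ σ u
hitsFrom-< {ℓ} {u} σ u<ℓ with <-cmp u ℓ
... | tri< _ _ _   = refl
... | tri≈ _ u≡ℓ _ = ⊥-elim (<-irrefl u≡ℓ u<ℓ)
... | tri> _ _ u>ℓ = ⊥-elim (<-asym u<ℓ u>ℓ)

hitsFrom-≡ : ∀ ℓ σ → hitsFrom ℓ σ ℓ ≡ true
hitsFrom-≡ ℓ σ with <-cmp ℓ ℓ
... | tri< ℓ<ℓ _ _ = ⊥-elim (<-irrefl refl ℓ<ℓ)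
... | tri≈ _ _ _   = refl
... | tri> _ _ ℓ>ℓ = ⊥-elim (<-irrefl refl ℓ>ℓ)

hitsFrom-> : ∀ {ℓ u} σ → ℓ < u → hitsFrom ℓ σ u ≡ false
hitsFrom-> {ℓ} {u} σ ℓ<u with <-cmp u ℓ
... | tri< u<ℓ _ _ = ⊥-elim (<-asym u<ℓ ℓ<u)
... | tri≈ _ u≡ℓ _ = ⊥-elim (<-irrefl (sym u≡ℓ) ℓ<u)
... | tri> _ _ _   = refl

hitsFrom-cong : ∀ {ℓ} σ τ → (∀ u → u < ℓ → hits ℓ σ u ≡ hits ℓ τ u) →
                ∀ u → hitsFrom ℓ σ u ≡ hitsFrom ℓ τ u
hitsFrom-cong {ℓ} σ τ eq u with <-cmp u ℓ
... | tri< u<ℓ _ _ = eq u u<ℓ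
... | tri≈ _ _ _   = refl
... | tri> _ _ _   = refl

hitsFrom-+ : ∀ {ℓ u} r σ τ → (u < ℓ → hits (ℓ + r) σ (u + r) ≡ hits ℓ τ u) →
             hitsFrom (ℓ + r) σ (u + r) ≡ hitsFrom ℓ τ u
hitsFrom-+ {ℓ} {u} r σ τ eq with <-cmp u ℓ
... | tri< u<ℓ _ _  = trans (hitsFrom-< σ (+-monoˡ-< r u<ℓ)) (eq u<ℓ)
... | tri≈ _ refl _ = hitsFrom-≡ (u + r) σ
... | tri> _ _ u>ℓ  = hitsFrom-> σ (+-monoˡ-< r u>ℓ)

hitsFrom-true : ∀ {ℓ u} σ → ℓ ≤ u → hitsFrom ℓ σ u ≡ true → ℓ ≡ u
hitsFrom-true σ ℓ≤u hit with m≤n⇒m<n∨m≡n ℓ≤u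
... | inj₂ ℓ≡u = ℓ≡u
... | inj₁ ℓ<u with () ← trans (sym hit) (hitsFrom-> σ ℓ<u)

vertical-misses : ∀ ℓ j σ → 0 < j → j ≤ ℓ + 0 → hits ℓ ((0 , j) ∷ σ) ℓ ≡ false
vertical-misses ℓ j σ j>0 j≤ℓ =
  hitsFrom-> σ (<-≤-trans (∸-monoʳ-< j>0 j≤ℓ) (≤-reflexive (+-identityʳ ℓ)))

activeAfter-< : ∀ {i k} ℓ σ → k < i → activeAfter i ℓ σ k ≡ false
activeAfter-< {i} {k} ℓ σ k<i with <-cmp k i
... | tri< _ _ _   = refl
... | tri≈ _ k≡i _ = ⊥-elim (<-irrefl k≡i k<i)
... | tri> _ _ k>i = ⊥-elim (<-asym k<i k>i)

activeAfter-≡ : ∀ i ℓ σ → activeAfter i ℓ σ i ≡ (hits ℓ σ ℓ ∨ active ℓ σ 0)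
activeAfter-≡ i ℓ σ with <-cmp i i
... | tri< i<i _ _ = ⊥-elim (<-irrefl refl i<i)
... | tri≈ _ _ _   = refl
... | tri> _ _ i>i = ⊥-elim (<-irrefl refl i>i)

activeAfter-> : ∀ {i k} ℓ σ → i < k → activeAfter i ℓ σ k ≡ active ℓ σ (k ∸ i)
activeAfter-> {i} {k} ℓ σ i<k with <-cmp k i
... | tri< k<i _ _ = ⊥-elim (<-asym k<i i<k)
... | tri≈ _ k≡i _ = ⊥-elim (<-irrefl (sym k≡i) i<k)
... | tri> _ _ _   = refl

activeAfter-cong : ∀ i {ℓ ℓ′} σ τ → hits ℓ σ ℓ ≡ hits ℓ′ τ ℓ′ →
                   (∀ k → active ℓ σ k ≡ active ℓ′ τ k) →
                   ∀ k → activeAfter i ℓ σ k ≡ activeAfter i ℓ′ τ k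
activeAfter-cong i σ τ hits≡ active≡ k with <-cmp k i
... | tri< _ _ _ = refl
... | tri≈ _ _ _ = cong₂ _∨_ hits≡ (active≡ 0)
... | tri> _ _ _ = active≡ (k ∸ i)

activeAfter-+ : ∀ a i ℓ σ k → activeAfter (a + i) ℓ σ (a + k) ≡ activeAfter i ℓ σ k
activeAfter-+ a i ℓ σ k with <-cmp k i
... | tri< k<i _ _  = activeAfter-< ℓ σ (+-monoʳ-< a k<i)
... | tri≈ _ refl _ = activeAfter-≡ (a + k) ℓ σ
... | tri> _ _ k>i  =
  trans (activeAfter-> ℓ σ (+-monoʳ-< a k>i)) (cong (active ℓ σ) ([m+n]∸[m+o]≡n∸o a k i))

activeAfter-+-self : ∀ i ℓ σ c → activeAfter i ℓ σ (i + c) ≡ activeAfter 0 ℓ σ c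
activeAfter-+-self i ℓ σ c =
  trans (cong (λ x → activeAfter x ℓ σ (i + c)) (sym (+-identityʳ i))) (activeAfter-+ i 0 ℓ σ c)

-- Moving the down-steps of the first return

-- d is the height above the start of the walk. adjust f replaces the down-steps j of the
-- first step that ends at or below the starting height by f j, and depth is how far
-- below that height it ends. Below, a walk starts at height m and is at height d + m.
adjust : (ℕ → ℕ) → ℕ → Path → Path
adjust f d [] = []
adjust f d ((i , j) ∷ σ) with d + i ≤? j
... | yes _ = (i , f j) ∷ σ
... | no  _ = (i , j) ∷ adjust f (d ▸ (i , j)) σ

lift lower : ℕ → ℕ → Path → Path
lift  r = adjust (_+ r)
lower r = adjust (_∸ r)

depth : ℕ → Path → ℕ
depth d [] = 0
depth d ((i , j) ∷ σ) with d + i ≤? j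
... | yes _ = j ∸ (d + i)
... | no  _ = depth (d ▸ (i , j)) σ

▸-+ : ∀ d m i j → j ≤ d + i → (d + m) ▸ (i , j) ≡ d ▸ (i , j) + m
▸-+ d m i j j≤d+i = trans (cong (_∸ j) (xy∙z≈xz∙y d m i)) (+-∸-comm m j≤d+i)

▸-lift : ∀ d m r i j → (d + m + r) ▸ (i , j + r) ≡ (d + m) ▸ (i , j)
▸-lift d m r i j = begin
  d + m + r + i ∸ (j + r)    ≡⟨ cong₂ _∸_ (xy∙z≈y∙xz (d + m) r i) (+-comm j r) ⟩
  r + (d + m + i) ∸ (r + j)  ≡⟨ [m+n]∸[m+o]≡n∸o r (d + m + i) j ⟩
  d + m + i ∸ j              ∎
  where open ≡-Reasoning

▸-+-+ : ∀ d m r i j → j ≤ d + i → (d + m + r) ▸ (i , j) ≡ d ▸ (i , j) + m + r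
▸-+-+ d m r i j j≤d+i =
  trans (▸-+ (d + m) r i j (≤-trans j≤d+i (+-monoˡ-≤ i (m≤m+n d m))))
        (cong (_+ r) (▸-+ d m i j j≤d+i))

▸-landing : ∀ d m i j → d + i ≤ j → (d + m) ▸ (i , j) ≤ m
▸-landing d m i j d+i≤j = begin
  d + m + i ∸ j    ≡⟨ cong (_∸ j) (xy∙z≈y∙xz d m i) ⟩
  m + (d + i) ∸ j  ≤⟨ ∸-monoˡ-≤ j (+-monoʳ-≤ m d+i≤j) ⟩
  m + j ∸ j        ≡⟨ m+n∸n≡m m j ⟩
  m                ∎
  where open ≤-Reasoning

▸-exact : ∀ d m i → (d + m) ▸ (i , d + i) ≡ m
▸-exact d m i = trans (cong (_∸ (d + i)) (xy∙z≈xz∙y d m i)) (m+n∸m≡n (d + i) m)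

▸-depth : ∀ d m i j → d + i ≤ j → (d + m + (j ∸ (d + i))) ▸ (i , j) ≡ m
▸-depth d m i j d+i≤j = begin
  (d + m + r) ▸ (i , j)            ≡⟨ cong (λ x → (d + m + r) ▸ (i , x)) (sym (m+[n∸m]≡n d+i≤j)) ⟩
  (d + m + r) ▸ (i , d + i + r)    ≡⟨ ▸-lift d m r i (d + i) ⟩
  (d + m) ▸ (i , d + i)            ≡⟨ ▸-exact d m i ⟩
  m                                ∎
  where
  open ≡-Reasoning
  r = j ∸ (d + i)

▸-pos : ∀ d i j → ¬ d + i ≤ j → 0 < d ▸ (i , j)
▸-pos d i j d+i≰j = m<n⇒0<n∸m (≰⇒> d+i≰j)

exact-landing : ∀ d m i j → j ≤ d + m + i → d + m + i ∸ j ≡ m → j ≡ d + i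
exact-landing d m i j j≤ lands = +-cancelˡ-≡ m j (d + i) (begin
  m + j              ≡⟨ cong (_+ j) (sym lands) ⟩
  d + m + i ∸ j + j  ≡⟨ m∸n+n≡m j≤ ⟩
  d + m + i          ≡⟨ xy∙z≈y∙xz d m i ⟩
  m + (d + i)        ∎)
  where open ≡-Reasoning

adjust-width : ∀ f d σ → width (adjust f d σ) ≡ width σ
adjust-width f d [] = refl
adjust-width f d ((i , j) ∷ σ) with d + i ≤? j
... | yes _ = refl
... | no  _ = cong (i +_) (adjust-width f (d ▸ (i , j)) σ)

adjust-head : ∀ f d i j σ → ∃₂ λ j′ σ′ → adjust f d ((i , j) ∷ σ) ≡ (i , j′) ∷ σ′
adjust-head f d i j σ with d + i ≤? j
... | yes _ = f j , σ , refl
... | no  _ = j , adjust f (d ▸ (i , j)) σ , refl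

adjust-≢[] : ∀ f d σ → σ ≢ [] → adjust f d σ ≢ []
adjust-≢[] f d [] σ≢[] = ⊥-elim (σ≢[] refl)
adjust-≢[] f d ((i , j) ∷ σ) _ with d + i ≤? j
... | yes _ = λ ()
... | no  _ = λ ()

lower-lift : ∀ r d σ → lower r d (lift r d σ) ≡ σ
lower-lift r d [] = refl
lower-lift r d ((i , j) ∷ σ) with d + i ≤? j
... | yes d+i≤j with d + i ≤? j + r
...   | yes _       = cong (λ x → (i , x) ∷ σ) (m+n∸n≡m j r)
...   | no  d+i≰j+r = ⊥-elim (d+i≰j+r (≤-trans d+i≤j (m≤m+n j r)))
lower-lift r d ((i , j) ∷ σ) | no d+i≰j with d + i ≤? j
...   | yes d+i≤j = ⊥-elim (d+i≰j d+i≤j)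
...   | no  _     = cong ((i , j) ∷_) (lower-lift r (d ▸ (i , j)) σ)

lift-lower : ∀ d ρ → lift (depth d ρ) d (lower (depth d ρ) d ρ) ≡ ρ
lift-lower d [] = refl
lift-lower d ((i , j) ∷ ρ) with d + i ≤? j
... | no  d+i≰j with d + i ≤? j
...   | yes d+i≤j = ⊥-elim (d+i≰j d+i≤j)
...   | no  _     = cong ((i , j) ∷_) (lift-lower (d ▸ (i , j)) ρ)
lift-lower d ((i , j) ∷ ρ) | yes d+i≤j with d + i ≤? j ∸ (j ∸ (d + i))
...   | yes _ = cong (λ x → (i , x) ∷ ρ) (m∸n+n≡m (m∸n≤m j (d + i)))
...   | no  d+i≰ = ⊥-elim (d+i≰ (≤-reflexive (sym (m∸[m∸n]≡n d+i≤j))))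

lift-valid : ∀ r d m σ → σ ≢ [] → Subdiagonal (d + m) σ → Subdiagonal (d + m + r) (lift r d σ)
lift-valid r d m [] σ≢[] _ = ⊥-elim (σ≢[] refl)
lift-valid r d m ((i , j) ∷ σ) _ (step i+j>0 j≤ σ-sub) with d + i ≤? j
... | yes _ = step (≤-trans i+j>0 (+-monoʳ-≤ i (m≤m+n j r)))
                   (≤-trans (+-monoˡ-≤ r j≤) (≤-reflexive (xy∙z≈xz∙y (d + m) i r)))
                   (subst (λ x → Subdiagonal x σ) (sym (▸-lift d m r i j)) σ-sub)
... | no d+i≰j =
  step i+j>0 (≤-trans j≤ (+-monoˡ-≤ i (m≤m+n (d + m) r)))
       (subst (λ x → Subdiagonal x (lift r d′ σ)) (sym (▸-+-+ d m r i j j≤d+i))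
         (lift-valid r d′ m σ (Subdiagonal-≢[] (≤-trans (▸-pos d i j d+i≰j) (m≤m+n d′ m)) σ′-sub)
           σ′-sub))
  where
  d′ = d ▸ (i , j)
  j≤d+i = <⇒≤ (≰⇒> d+i≰j)
  σ′-sub = subst (λ x → Subdiagonal x σ) (▸-+ d m i j j≤d+i) σ-sub

lift-hits-≤ : ∀ r d m σ {u} → u ≤ m → hits (d + m + r) (lift r d σ) u ≡ hits (d + m) σ u
lift-hits-≤ r d m [] u≤m = refl
lift-hits-≤ r d m ((i , j) ∷ σ) {u} u≤m with d + i ≤? j
... | yes _ = cong (λ x → hitsFrom x σ u) (▸-lift d m r i j)
... | no d+i≰j rewrite ▸-+-+ d m r i j (<⇒≤ (≰⇒> d+i≰j)) | ▸-+ d m i j (<⇒≤ (≰⇒> d+i≰j)) =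
  begin
    hitsFrom (d′ + m + r) (lift r d′ σ) u  ≡⟨ hitsFrom-< (lift r d′ σ) (<-≤-trans u<d′+m (m≤m+n _ r)) ⟩
    hits (d′ + m + r) (lift r d′ σ) u      ≡⟨ lift-hits-≤ r d′ m σ u≤m ⟩
    hits (d′ + m) σ u                      ≡⟨ sym (hitsFrom-< σ u<d′+m) ⟩
    hitsFrom (d′ + m) σ u                  ∎
  where
  open ≡-Reasoning
  d′ = d ▸ (i , j)
  u<d′+m = ≤-<-trans u≤m (m<n+m m (▸-pos d i j d+i≰j))

lift-hits-mid : ∀ r d m σ {u} → m < u → u ≤ m + r → hits (d + m + r) (lift r d σ) u ≡ false
lift-hits-mid r d m [] m<u u≤m+r = refl
lift-hits-mid r d m ((i , j) ∷ σ) {u} m<u u≤m+r with d + i ≤? j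
... | yes d+i≤j = trans (cong (λ x → hitsFrom x σ u) (▸-lift d m r i j))
                        (hitsFrom-> σ (≤-<-trans (▸-landing d m i j d+i≤j) m<u))
... | no d+i≰j rewrite ▸-+-+ d m r i j (<⇒≤ (≰⇒> d+i≰j)) =
  trans (hitsFrom-< (lift r (d ▸ (i , j)) σ)
          (≤-<-trans u≤m+r (+-monoˡ-< r (m<n+m m (▸-pos d i j d+i≰j)))))
        (lift-hits-mid r (d ▸ (i , j)) m σ m<u u≤m+r)

lift-hits-> : ∀ r d m σ {u} → m < u → hits (d + m + r) (lift r d σ) (u + r) ≡ hits (d + m) σ u
lift-hits-> r d m [] m<u = refl
lift-hits-> r d m ((i , j) ∷ σ) {u} m<u with d + i ≤? j
... | yes d+i≤j = begin
  hitsFrom ((d + m + r) ▸ (i , j + r)) σ (u + r)  ≡⟨ cong (λ x → hitsFrom x σ (u + r)) (▸-lift d m r i j) ⟩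
  hitsFrom ((d + m) ▸ (i , j)) σ (u + r)          ≡⟨ hitsFrom-> σ (≤-trans landing<u (m≤m+n u r)) ⟩
  false                                           ≡⟨ sym (hitsFrom-> σ landing<u) ⟩
  hitsFrom ((d + m) ▸ (i , j)) σ u                ∎
  where
  open ≡-Reasoning
  landing<u = ≤-<-trans (▸-landing d m i j d+i≤j) m<u
... | no d+i≰j rewrite ▸-+-+ d m r i j (<⇒≤ (≰⇒> d+i≰j)) | ▸-+ d m i j (<⇒≤ (≰⇒> d+i≰j)) =
  hitsFrom-+ r (lift r (d ▸ (i , j)) σ) σ (λ _ → lift-hits-> r (d ▸ (i , j)) m σ m<u)

lift-hits-returning : ∀ r m σ {u} → hits m σ m ≡ true → u ≤ m + r →
                      hits (m + r) (lift r 0 σ) u ≡ hitsFrom m σ u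
lift-hits-returning r m σ {u} hit u≤m+r with <-cmp u m
... | tri< u<m _ _  = lift-hits-≤ r 0 m σ (<⇒≤ u<m)
... | tri≈ _ refl _ = trans (lift-hits-≤ r 0 u σ ≤-refl) hit
... | tri> _ _ u>m  = lift-hits-mid r 0 m σ u>m u≤m+r

lift-active : ∀ r d m σ k → active (d + m + r) (lift r d σ) k ≡ active (d + m) σ k
lift-active r d m [] k = refl
lift-active r d m ((i , j) ∷ σ) k with d + i ≤? j
... | yes _ = cong (λ x → activeAfter i x σ k) (▸-lift d m r i j)
... | no d+i≰j rewrite ▸-+-+ d m r i j (<⇒≤ (≰⇒> d+i≰j)) | ▸-+ d m i j (<⇒≤ (≰⇒> d+i≰j)) =
  activeAfter-cong i (lift r d′ σ) σ
    (lift-hits-> r d′ m σ (m<n+m m (▸-pos d i j d+i≰j)))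
    (lift-active r d′ m σ) k
  where d′ = d ▸ (i , j)

depth-lift : ∀ r d m σ → Subdiagonal (d + m) σ → hits (d + m) σ m ≡ true →
             depth d (lift r d σ) ≡ r
depth-lift r d m ((i , j) ∷ σ) (step _ j≤ σ-sub) hit with d + i ≤? j
... | yes d+i≤j with d + i ≤? j + r
...   | no d+i≰j+r = ⊥-elim (d+i≰j+r (≤-trans d+i≤j (m≤m+n j r)))
...   | yes _ = begin
  j + r ∸ (d + i)      ≡⟨ cong (λ x → x + r ∸ (d + i)) j≡d+i ⟩
  d + i + r ∸ (d + i)  ≡⟨ m+n∸m≡n (d + i) r ⟩
  r                    ∎
  where
  open ≡-Reasoning
  j≡d+i = exact-landing d m i j j≤ (hitsFrom-true σ (▸-landing d m i j d+i≤j) hit)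
depth-lift r d m ((i , j) ∷ σ) (step _ j≤ σ-sub) hit | no d+i≰j
  rewrite ▸-+ d m i j (<⇒≤ (≰⇒> d+i≰j)) with d + i ≤? j
... | yes d+i≤j = ⊥-elim (d+i≰j d+i≤j)
... | no _ = depth-lift r (d ▸ (i , j)) m σ σ-sub
               (trans (sym (hitsFrom-< σ (m<n+m m (▸-pos d i j d+i≰j)))) hit)

depth-≤ : ∀ d M ρ → Subdiagonal (d + M) ρ → depth d ρ ≤ M
depth-≤ d M [] _ = z≤n
depth-≤ d M ((i , j) ∷ ρ) (step _ j≤ ρ-sub) with d + i ≤? j
... | yes _ = begin
  j ∸ (d + i)          ≤⟨ ∸-monoˡ-≤ (d + i) j≤ ⟩
  d + M + i ∸ (d + i)  ≡⟨ cong (_∸ (d + i)) (xy∙z≈xz∙y d M i) ⟩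
  d + i + M ∸ (d + i)  ≡⟨ m+n∸m≡n (d + i) M ⟩
  M                    ∎
  where open ≤-Reasoning
... | no d+i≰j =
  depth-≤ (d ▸ (i , j)) M ρ (subst (λ x → Subdiagonal x ρ) (▸-+ d M i j (<⇒≤ (≰⇒> d+i≰j))) ρ-sub)

lower-valid : ∀ d m ρ → (∀ {i j ρ′} → ρ ≡ (i , j) ∷ ρ′ → 0 < d + i) →
              Subdiagonal (d + m + depth d ρ) ρ → Subdiagonal (d + m) (lower (depth d ρ) d ρ)
lower-valid d m [] _ ρ-sub =
  subst (λ x → Subdiagonal x []) (sym (trans (sym (+-identityʳ (d + m))) (Subdiagonal-[] ρ-sub))) end
lower-valid d m ((i , j) ∷ ρ) wide (step i+j>0 j≤ ρ-sub) with d + i ≤? j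
... | yes d+i≤j =
  subst (λ x → Subdiagonal (d + m) ((i , x) ∷ ρ)) (sym (m∸[m∸n]≡n d+i≤j))
    (step (≤-trans (wide refl) (m≤n+m (d + i) i)) (+-monoˡ-≤ i (m≤m+n d m))
      (subst (λ x → Subdiagonal x ρ) (trans (▸-depth d m i j d+i≤j) (sym (▸-exact d m i))) ρ-sub))
... | no d+i≰j =
  step i+j>0 (≤-trans j≤d+i (+-monoˡ-≤ i (m≤m+n d m)))
    (subst (λ x → Subdiagonal x (lower (depth d′ ρ) d′ ρ)) (sym (▸-+ d m i j j≤d+i))
      (lower-valid d′ m ρ (λ _ → ≤-trans (▸-pos d i j d+i≰j) (m≤m+n d′ _))
        (subst (λ x → Subdiagonal x ρ) (▸-+-+ d m (depth d′ ρ) i j j≤d+i) ρ-sub)))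
  where
  d′ = d ▸ (i , j)
  j≤d+i = <⇒≤ (≰⇒> d+i≰j)

lower-returns : ∀ d m ρ → ρ ≢ [] → Subdiagonal (d + m + depth d ρ) ρ →
                hits (d + m) (lower (depth d ρ) d ρ) m ≡ true
lower-returns d m [] ρ≢[] _ = ⊥-elim (ρ≢[] refl)
lower-returns d m ((i , j) ∷ ρ) _ (step _ _ ρ-sub) with d + i ≤? j
... | yes d+i≤j = begin
  hitsFrom ((d + m) ▸ (i , j ∸ (j ∸ (d + i)))) ρ m
    ≡⟨ cong (λ x → hitsFrom ((d + m) ▸ (i , x)) ρ m) (m∸[m∸n]≡n d+i≤j) ⟩
  hitsFrom ((d + m) ▸ (i , d + i)) ρ m              ≡⟨ cong (λ x → hitsFrom x ρ m) (▸-exact d m i) ⟩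
  hitsFrom m ρ m                                    ≡⟨ hitsFrom-≡ m ρ ⟩
  true                                              ∎
  where open ≡-Reasoning
... | no d+i≰j rewrite ▸-+ d m i j (<⇒≤ (≰⇒> d+i≰j)) =
  trans (hitsFrom-< (lower (depth d′ ρ) d′ ρ) (m<n+m m d′>0))
        (lower-returns d′ m ρ
          (Subdiagonal-≢[] (≤-trans d′>0 (≤-trans (m≤m+n d′ m) (m≤m+n _ _))) ρ′-sub) ρ′-sub)
  where
  d′ = d ▸ (i , j)
  d′>0 = ▸-pos d i j d+i≰j
  ρ′-sub = subst (λ x → Subdiagonal x ρ) (▸-+-+ d m (depth d′ ρ) i j (<⇒≤ (≰⇒> d+i≰j))) ρ-sub

hits-depth : ∀ C ρ → ρ ≢ [] → Subdiagonal C ρ → hits C ρ (C ∸ depth 0 ρ) ≡ true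
hits-depth C ρ ρ≢[] ρ-sub = begin
  hits C ρ m                            ≡⟨ cong (λ x → hits x ρ m) (sym m+r≡C) ⟩
  hits (m + r) ρ m                      ≡⟨ cong (λ x → hits (m + r) x m) (sym (lift-lower 0 ρ)) ⟩
  hits (m + r) (lift r 0 (lower r 0 ρ)) m  ≡⟨ lift-hits-≤ r 0 m (lower r 0 ρ) ≤-refl ⟩
  hits m (lower r 0 ρ) m
    ≡⟨ lower-returns 0 m ρ ρ≢[] (subst (λ x → Subdiagonal x ρ) (sym m+r≡C) ρ-sub) ⟩
  true                                  ∎
  where
  open ≡-Reasoning
  r = depth 0 ρ
  m = C ∸ r
  m+r≡C = m∸n+n≡m (depth-≤ 0 C ρ ρ-sub)

-- Widening the first step

widen : ℕ → Path → Path
widen a []            = []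
widen a ((i , j) ∷ σ) = (a + i , j) ∷ σ

▸-widen : ∀ h a i j → h ▸ (a + i , j) ≡ (h + a) ▸ (i , j)
▸-widen h a i j = cong (_∸ j) (sym (+-assoc h a i))

widen-valid : ∀ h a ρ → Subdiagonal (h + a) ρ → Subdiagonal h (widen a ρ)
widen-valid h a [] ρ-sub = subst (λ x → Subdiagonal x []) (sym (m+n≡0⇒m≡0 h (Subdiagonal-[] ρ-sub))) end
widen-valid h a ((i , j) ∷ σ) (step i+j>0 j≤ σ-sub) =
  step (≤-trans i+j>0 (+-monoˡ-≤ j (m≤n+m i a)))
       (≤-trans j≤ (≤-reflexive (+-assoc h a i)))
       (subst (λ x → Subdiagonal x σ) (sym (▸-widen h a i j)) σ-sub)

unwiden-valid : ∀ h a i j σ → 0 < i → Subdiagonal h ((a + i , j) ∷ σ) →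
                Subdiagonal (h + a) ((i , j) ∷ σ)
unwiden-valid h a i j σ i>0 (step _ j≤ σ-sub) =
  step (≤-trans i>0 (m≤m+n i j)) (≤-trans j≤ (≤-reflexive (sym (+-assoc h a i))))
       (subst (λ x → Subdiagonal x σ) (▸-widen h a i j) σ-sub)

widen-width : ∀ a ρ → ρ ≢ [] → width (widen a ρ) ≡ a + width ρ
widen-width a [] ρ≢[] = ⊥-elim (ρ≢[] refl)
widen-width a ((i , j) ∷ σ) _ = +-assoc a i (width σ)

hits-widen : ∀ h a ρ u → hits h (widen a ρ) u ≡ hits (h + a) ρ u
hits-widen h a [] u = refl
hits-widen h a ((i , j) ∷ σ) u = cong (λ x → hitsFrom x σ u) (▸-widen h a i j)

active-widen : ∀ h a ρ k → active h (widen a ρ) (a + k) ≡ active (h + a) ρ k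
active-widen h a [] k = refl
active-widen h a ((i , j) ∷ σ) k =
  trans (activeAfter-+ a i _ σ k) (cong (λ x → activeAfter i x σ k) (▸-widen h a i j))

active-widen-< : ∀ h a ρ {k} → k < a → active h (widen a ρ) k ≡ false
active-widen-< h a [] k<a = refl
active-widen-< h a ((i , j) ∷ σ) k<a = activeAfter-< _ σ (≤-trans k<a (m≤m+n a i))

-- Toggling one line

merge : ℕ → ℕ → Path → Path
merge k r σ = widen k (lift r 0 σ)

split : ℕ → Path → Path
split k ρ = (k , depth 0 ρ) ∷ lower (depth 0 ρ) 0 ρ

-- toggle k h σ toggles the line at abscissa k relative to the start of σ, of height h.
toggle : ℕ → ℕ → Path → Path
toggle k h [] = []
toggle k h ((i , j) ∷ σ) with <-cmp i k
... | tri< _ _ _ = (i , j) ∷ toggle (k ∸ i) (h ▸ (i , j)) σ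
... | tri> _ _ _ = split k ((i ∸ k , j) ∷ σ)
... | tri≈ _ _ _ with hits (h ▸ (i , j)) σ (h ▸ (i , j))
...   | true  = merge i j σ
...   | false = (i , j) ∷ toggle 0 (h ▸ (i , j)) σ

toggle-returning : ∀ k h r σ → hits (h ▸ (k , r)) σ (h ▸ (k , r)) ≡ true →
                   toggle k h ((k , r) ∷ σ) ≡ merge k r σ
toggle-returning k h r σ hit with <-cmp k k
... | tri< k<k _ _ = ⊥-elim (<-irrefl refl k<k)
... | tri> _ _ k>k = ⊥-elim (<-irrefl refl k>k)
... | tri≈ _ _ _ rewrite hit = refl

toggle-across : ∀ k h c j σ → toggle k h ((k + suc c , j) ∷ σ) ≡ split k ((suc c , j) ∷ σ)
toggle-across k h c j σ with <-cmp (k + suc c) k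
... | tri< k+c<k _ _ = ⊥-elim (<-asym k+c<k (m<m+n k z<s))
... | tri≈ _ k+c≡k _ = ⊥-elim (m+1+n≢m k k+c≡k)
... | tri> _ _ _     = cong (λ x → split k ((x , j) ∷ σ)) (m+n∸m≡n k (suc c))

toggle-∷ : ∀ i j c h τ → 0 < c ⊎ hits (h ▸ (i , j)) τ (h ▸ (i , j)) ≡ false →
           toggle (i + c) h ((i , j) ∷ τ) ≡ (i , j) ∷ toggle c (h ▸ (i , j)) τ
toggle-∷ i j zero h τ (inj₂ miss) with <-cmp i (i + 0)
... | tri< i<i _ _ = ⊥-elim (<-irrefl (sym (+-identityʳ i)) i<i)
... | tri> _ _ i>i = ⊥-elim (<-irrefl (+-identityʳ i) i>i)
... | tri≈ _ _ _ rewrite miss = refl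
toggle-∷ i j (suc c) h τ _ with <-cmp i (i + suc c)
... | tri< _ _ _     = cong (λ x → (i , j) ∷ toggle x (h ▸ (i , j)) τ) (m+n∸m≡n i (suc c))
... | tri≈ _ i≡i+c _ = ⊥-elim (m+1+n≢m i (sym i≡i+c))
... | tri> _ _ i>i+c = ⊥-elim (<-asym i>i+c (m<m+n i z<s))

split-lift : ∀ k r m σ → Subdiagonal m σ → hits m σ m ≡ true → split k (lift r 0 σ) ≡ (k , r) ∷ σ
split-lift k r m σ σ-sub hit rewrite depth-lift r 0 m σ σ-sub hit = cong ((k , r) ∷_) (lower-lift r 0 σ)

merge-valid : ∀ k h r σ → σ ≢ [] → Subdiagonal h ((k , r) ∷ σ) → Subdiagonal h (merge k r σ)
merge-valid k h r σ σ≢[] (step _ r≤h+k σ-sub) =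
  widen-valid h k (lift r 0 σ)
    (subst (λ x → Subdiagonal x (lift r 0 σ)) (m∸n+n≡m r≤h+k) (lift-valid r 0 (h ▸ (k , r)) σ σ≢[] σ-sub))

merge-width : ∀ k r σ → σ ≢ [] → width (merge k r σ) ≡ k + width σ
merge-width k r σ σ≢[] =
  trans (widen-width k (lift r 0 σ) (adjust-≢[] (_+ r) 0 σ σ≢[])) (cong (k +_) (adjust-width (_+ r) 0 σ))

hits-merge : ∀ k h r σ {u} → r ≤ h + k → hits (h ▸ (k , r)) σ (h ▸ (k , r)) ≡ true → u ≤ h + k →
             hits h (merge k r σ) u ≡ hits h ((k , r) ∷ σ) u
hits-merge k h r σ {u} r≤h+k hit u≤h+k = begin
  hits h (widen k (lift r 0 σ)) u  ≡⟨ hits-widen h k (lift r 0 σ) u ⟩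
  hits (h + k) (lift r 0 σ) u      ≡⟨ cong (λ x → hits x (lift r 0 σ) u) (sym ℓ+r≡h+k) ⟩
  hits (ℓ + r) (lift r 0 σ) u      ≡⟨ lift-hits-returning r ℓ σ hit (subst (u ≤_) (sym ℓ+r≡h+k) u≤h+k) ⟩
  hitsFrom ℓ σ u                   ∎
  where
  open ≡-Reasoning
  ℓ = h ▸ (k , r)
  ℓ+r≡h+k = m∸n+n≡m r≤h+k

active-merge : ∀ k h r σ m → r ≤ h + k → active h (merge k r σ) (k + m) ≡ active (h ▸ (k , r)) σ m
active-merge k h r σ m r≤h+k = begin
  active h (widen k (lift r 0 σ)) (k + m)  ≡⟨ active-widen h k (lift r 0 σ) m ⟩
  active (h + k) (lift r 0 σ) m            ≡⟨ cong (λ x → active x (lift r 0 σ) m) (sym (m∸n+n≡m r≤h+k)) ⟩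
  active (h ▸ (k , r) + r) (lift r 0 σ) m  ≡⟨ lift-active r 0 (h ▸ (k , r)) σ m ⟩
  active (h ▸ (k , r)) σ m                 ∎
  where open ≡-Reasoning

toggle-merge : ∀ k h r i j σ → Subdiagonal (h ▸ (k , r)) ((suc i , j) ∷ σ) →
               hits (h ▸ (k , r)) ((suc i , j) ∷ σ) (h ▸ (k , r)) ≡ true →
               toggle k h (merge k r ((suc i , j) ∷ σ)) ≡ (k , r) ∷ (suc i , j) ∷ σ
toggle-merge k h r i j σ σ-sub hit = begin
  toggle k h (widen k ρ)              ≡⟨ cong (toggle k h ∘ widen k) ρ≡ ⟩
  toggle k h ((k + suc i , j′) ∷ ρ′)  ≡⟨ toggle-across k h i j′ ρ′ ⟩
  split k ((suc i , j′) ∷ ρ′)         ≡⟨ cong (split k) (sym ρ≡) ⟩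
  split k ρ                           ≡⟨ split-lift k r (h ▸ (k , r)) _ σ-sub hit ⟩
  (k , r) ∷ (suc i , j) ∷ σ           ∎
  where
  open ≡-Reasoning
  ρ = lift r 0 ((suc i , j) ∷ σ)
  ρ-head = adjust-head (_+ r) 0 (suc i) j σ
  j′ = proj₁ ρ-head
  ρ′ = proj₁ (proj₂ ρ-head)
  ρ≡ = proj₂ (proj₂ ρ-head)

record Toggles (k h : ℕ) (σ τ : Path) : Set where
  field
    subdiagonal : Subdiagonal h τ
    same-width  : width τ ≡ width σ
    same-hits   : ∀ u → u ≤ h → hits h τ u ≡ hits h σ u
    same-active : ∀ k′ → k′ ≢ k → active h τ k′ ≡ active h σ k′
    flips       : active h τ k ≡ not (active h σ k)
    involutive  : toggle k h τ ≡ σ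

toggles-sym : ∀ {k h σ τ} → Subdiagonal h σ → toggle k h σ ≡ τ → Toggles k h σ τ → Toggles k h τ σ
toggles-sym {k} {h} {σ} {τ} σ-sub σ↦τ t = record
  { subdiagonal = σ-sub
  ; same-width  = sym same-width
  ; same-hits   = λ u u≤h → sym (same-hits u u≤h)
  ; same-active = λ k′ k′≢k → sym (same-active k′ k′≢k)
  ; flips       = sym (trans (cong not flips) (not-involutive (active h σ k)))
  ; involutive  = σ↦τ
  }
  where open Toggles t

merge-toggles : ∀ k h r σ → Subdiagonal h ((k , r) ∷ σ) → hits (h ▸ (k , r)) σ (h ▸ (k , r)) ≡ true →
                Toggles k h ((k , r) ∷ σ) (merge k r σ)
merge-toggles k h r ((zero , j) ∷ σ) (step _ _ (step j>0 j≤ _)) hit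
  with () ← trans (sym hit) (vertical-misses (h ▸ (k , r)) j σ j>0 j≤)
merge-toggles k h r σ@((suc i , j) ∷ σ′) σ-sub@(step _ r≤h+k σ′-sub) hit = record
  { subdiagonal = merge-valid k h r σ (λ ()) σ-sub
  ; same-width  = merge-width k r σ (λ ())
  ; same-hits   = λ u u≤h → hits-merge k h r σ r≤h+k hit (≤-trans u≤h (m≤m+n h k))
  ; same-active = same-active
  ; flips       = flips
  ; involutive  = toggle-merge k h r i j σ′ σ′-sub hit
  }
  where
  ℓ = h ▸ (k , r)
  same-active : ∀ k′ → k′ ≢ k → active h (merge k r σ) k′ ≡ activeAfter k ℓ σ k′
  same-active k′ k′≢k with <-cmp k′ k
  ... | tri< k′<k _ _ = active-widen-< h k (lift r 0 σ) k′<k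
  ... | tri≈ _ k′≡k _ = ⊥-elim (k′≢k k′≡k)
  ... | tri> _ _ k′>k = trans (cong (active h (merge k r σ)) (sym (m+[n∸m]≡n (<⇒≤ k′>k))))
                              (active-merge k h r σ (k′ ∸ k) r≤h+k)
  flips : active h (merge k r σ) k ≡ not (activeAfter k ℓ σ k)
  flips rewrite activeAfter-≡ k ℓ σ | hit =
    trans (cong (active h (merge k r σ)) (sym (+-identityʳ k))) (active-merge k h r σ 0 r≤h+k)

split-nonzero : ∀ k h c j σ → Subdiagonal h ((k + suc c , j) ∷ σ) →
                0 < k ⊎ hits h ((k + suc c , j) ∷ σ) h ≡ false → 0 < k + depth 0 ((suc c , j) ∷ σ)
split-nonzero (suc k) h c j σ _ _ = z<s
split-nonzero zero h c j σ ρ-sub (inj₂ miss) = n≢0⇒n>0 λ r≡0 → not-¬ miss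
  (trans (cong (hits h ρ) (cong (h ∸_) (sym r≡0))) (hits-depth h ρ (λ ()) ρ-sub))
  where ρ = (suc c , j) ∷ σ

-- Splitting is the inverse of merging, applied to the split path.
split-toggles : ∀ k h c j σ → Subdiagonal h ((k + suc c , j) ∷ σ) →
                0 < k ⊎ hits h ((k + suc c , j) ∷ σ) h ≡ false →
                Toggles k h ((k + suc c , j) ∷ σ) (split k ((suc c , j) ∷ σ))
split-toggles k h c j σ σ-sub pre =
  subst (λ x → Toggles k h x (split k ρ)) (cong (widen k) (lift-lower 0 ρ))
    (toggles-sym α-sub (toggle-returning k h r L L-hit) (merge-toggles k h r L α-sub L-hit))
  where
  ρ = (suc c , j) ∷ σ
  r = depth 0 ρ
  m = h + k ∸ r
  L = lower r 0 ρ
  ρ-sub : Subdiagonal (h + k) ρ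
  ρ-sub = unwiden-valid h k (suc c) j σ z<s σ-sub
  r≤h+k = depth-≤ 0 (h + k) ρ ρ-sub
  ρ-sub′ : Subdiagonal (m + r) ρ
  ρ-sub′ = subst (λ x → Subdiagonal x ρ) (sym (m∸n+n≡m r≤h+k)) ρ-sub
  L-hit : hits m L m ≡ true
  L-hit = lower-returns 0 m ρ (λ ()) ρ-sub′
  α-sub : Subdiagonal h ((k , r) ∷ L)
  α-sub = step (split-nonzero k h c j σ σ-sub pre) r≤h+k (lower-valid 0 m ρ (λ { refl → z<s }) ρ-sub′)

∷-toggles : ∀ {c h i j σ τ} → 0 < c ⊎ hits (h ▸ (i , j)) σ (h ▸ (i , j)) ≡ false →
            Subdiagonal h ((i , j) ∷ σ) → Toggles c (h ▸ (i , j)) σ τ →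
            Toggles (i + c) h ((i , j) ∷ σ) ((i , j) ∷ τ)
∷-toggles {c} {h} {i} {j} {σ} {τ} pre (step i+j>0 j≤ _) t = record
  { subdiagonal = step i+j>0 j≤ subdiagonal
  ; same-width  = cong (i +_) same-width
  ; same-hits   = λ u _ → hitsFrom-cong τ σ (λ u′ u′<ℓ → same-hits u′ (<⇒≤ u′<ℓ)) u
  ; same-active = same-active′
  ; flips       = begin
      activeAfter i ℓ τ (i + c)        ≡⟨ activeAfter-+-self i ℓ τ c ⟩
      activeAfter 0 ℓ τ c              ≡⟨ flips₀ c pre flips ⟩
      not (activeAfter 0 ℓ σ c)        ≡⟨ cong not (sym (activeAfter-+-self i ℓ σ c)) ⟩
      not (activeAfter i ℓ σ (i + c))  ∎
  ; involutive  = trans (toggle-∷ i j c h τ (map₂ (trans (same-hits ℓ ≤-refl)) pre))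
                        (cong ((i , j) ∷_) involutive)
  }
  where
  open ≡-Reasoning
  open Toggles t
  ℓ = h ▸ (i , j)
  flips₀ : ∀ c → 0 < c ⊎ hits ℓ σ ℓ ≡ false → active ℓ τ c ≡ not (active ℓ σ c) →
           activeAfter 0 ℓ τ c ≡ not (activeAfter 0 ℓ σ c)
  flips₀ zero (inj₂ miss) τ-flips rewrite same-hits ℓ ≤-refl | miss = τ-flips
  flips₀ (suc c) _ τ-flips = τ-flips
  same-active′ : ∀ k′ → k′ ≢ i + c → activeAfter i ℓ τ k′ ≡ activeAfter i ℓ σ k′
  same-active′ k′ k′≢i+c with <-cmp k′ i
  ... | tri< _ _ _     = refl
  ... | tri≈ _ k′≡i _  = cong₂ _∨_ (same-hits ℓ ≤-refl)
                           (same-active 0 λ 0≡c →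
                             k′≢i+c (trans k′≡i (trans (sym (+-identityʳ i)) (cong (i +_) 0≡c))))
  ... | tri> _ _ i<k′  = same-active (k′ ∸ i) λ k′∸i≡c →
                           k′≢i+c (trans (sym (m+[n∸m]≡n (<⇒≤ i<k′))) (cong (i +_) k′∸i≡c))

toggles : ∀ k h σ → Subdiagonal h σ → k < width σ → 0 < k ⊎ hits h σ h ≡ false →
          Toggles k h σ (toggle k h σ)
toggles k h ((i , j) ∷ σ) σ-sub@(step _ _ σ′-sub) k<w pre with <-cmp i k
... | tri< i<k _ _ =
  subst (λ x → Toggles x h ((i , j) ∷ σ) ((i , j) ∷ toggle (k ∸ i) (h ▸ (i , j)) σ))
        (m+[n∸m]≡n (<⇒≤ i<k))
    (∷-toggles (inj₁ (m<n⇒0<n∸m i<k)) σ-sub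
      (toggles (k ∸ i) (h ▸ (i , j)) σ σ′-sub
        (+-cancelˡ-< i (k ∸ i) (width σ) (subst (_< i + width σ) (sym (m+[n∸m]≡n (<⇒≤ i<k))) k<w))
        (inj₁ (m<n⇒0<n∸m i<k))))
... | tri≈ _ refl _ with hits (h ▸ (i , j)) σ (h ▸ (i , j)) in hit
...   | true  = merge-toggles i h j σ σ-sub hit
...   | false =
  subst (λ x → Toggles x h ((i , j) ∷ σ) ((i , j) ∷ toggle 0 (h ▸ (i , j)) σ)) (+-identityʳ i)
    (∷-toggles (inj₂ hit) σ-sub
      (toggles 0 (h ▸ (i , j)) σ σ′-sub
        (+-cancelˡ-< i 0 (width σ) (subst (_< i + width σ) (sym (+-identityʳ i)) k<w))
        (inj₂ hit)))
toggles k h ((i , j) ∷ σ) σ-sub k<w pre | tri> _ _ k<i with i ∸ k | m+[n∸m]≡n (<⇒≤ k<i)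
... | zero  | refl = ⊥-elim (<-irrefl (sym (+-identityʳ k)) k<i)
... | suc c | refl = split-toggles k h c j σ σ-sub pre

-- Vertex coordinates

vx-length : ∀ π → vx π (length π) ≡ width π
vx-length []            = refl
vx-length ((a , _) ∷ π) = cong (a +_) (vx-length π)

shift : ∀ h a b X → b ≤ h + a → h + (a + X) ≡ b + (h ▸ (a , b) + X)
shift h a b X b≤h+a = begin
  h + (a + X)            ≡⟨ sym (+-assoc h a X) ⟩
  h + a + X              ≡⟨ cong (_+ X) (sym (m+[n∸m]≡n b≤h+a)) ⟩
  b + (h + a ∸ b) + X    ≡⟨ +-assoc b _ X ⟩
  b + (h ▸ (a , b) + X)  ∎
  where open ≡-Reasoning

shift-≤ : ∀ h a b u X Y → b ≤ h + a → (u + (b + Y) ≤ h + (a + X)) ⇔ (u + Y ≤ h ▸ (a , b) + X)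
shift-≤ h a b u X Y b≤h+a = mk⇔
  (λ le → +-cancelˡ-≤ b _ _ (subst₂ _≤_ (x∙yz≈y∙xz u b Y) (shift h a b X b≤h+a) le))
  (λ le → subst₂ _≤_ (sym (x∙yz≈y∙xz u b Y)) (sym (shift h a b X b≤h+a)) (+-monoʳ-≤ b le))

shift-≡ : ∀ h a b u X Y → b ≤ h + a → (h + (a + X) ≡ u + (b + Y)) ⇔ (h ▸ (a , b) + X ≡ u + Y)
shift-≡ h a b u X Y b≤h+a = mk⇔
  (λ e → +-cancelˡ-≡ b _ _ (trans (sym (shift h a b X b≤h+a)) (trans e (x∙yz≈y∙xz u b Y))))
  (λ e → trans (shift h a b X b≤h+a) (trans (cong (b +_) e) (sym (x∙yz≈y∙xz u b Y))))

NonZeroStep : Step → Set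
NonZeroStep s = ¬ (s ≡ (0 , 0))

nonZero⇒0<i+j : ∀ i j → NonZeroStep (i , j) → 0 < i + j
nonZero⇒0<i+j zero    zero    nz = ⊥-elim (nz refl)
nonZero⇒0<i+j zero    (suc j) _  = z<s
nonZero⇒0<i+j (suc i) j       _  = z<s

0<i+j⇒nonZero : ∀ i j → 0 < i + j → NonZeroStep (i , j)
0<i+j⇒nonZero zero zero () refl

Coordinates : ℕ → Path → Set
Coordinates h π = All NonZeroStep π × (∀ i → i ≤ length π → vy π i ≤ h + vx π i)
                  × h + vx π (length π) ≡ vy π (length π)

coordinates⇒Subdiagonal : ∀ h π → Coordinates h π → Subdiagonal h π
coordinates⇒Subdiagonal h [] (_ , _ , at-end) =
  subst (λ x → Subdiagonal x []) (sym (trans (sym (+-identityʳ h)) at-end)) end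
coordinates⇒Subdiagonal h ((a , b) ∷ π) (nz ∷ nzs , below , at-end) =
  step (nonZero⇒0<i+j a b nz) b≤h+a
    (coordinates⇒Subdiagonal (h ▸ (a , b)) π
      ( nzs
      , (λ i i≤ → Equivalence.to (shift-≤ h a b 0 (vx π i) (vy π i) b≤h+a) (below (suc i) (s≤s i≤)))
      , Equivalence.to (shift-≡ h a b 0 (vx π (length π)) (vy π (length π)) b≤h+a) at-end))
  where
  b≤h+a : b ≤ h + a
  b≤h+a = subst₂ _≤_ (+-identityʳ b) (cong (h +_) (+-identityʳ a)) (below 1 (s≤s z≤n))

Subdiagonal⇒coordinates : ∀ {h π} → Subdiagonal h π → Coordinates h π
Subdiagonal⇒coordinates end = [] , (λ { zero _ → z≤n }) , refl
Subdiagonal⇒coordinates {h} {(a , b) ∷ π} (step a+b>0 b≤h+a π-sub) =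
  let nzs , below , at-end = Subdiagonal⇒coordinates π-sub in
  0<i+j⇒nonZero a b a+b>0 ∷ nzs ,
  (λ { zero _ → z≤n
     ; (suc i) (s≤s i≤) → Equivalence.from (shift-≤ h a b 0 (vx π i) (vy π i) b≤h+a) (below i i≤) }) ,
  Equivalence.from (shift-≡ h a b 0 (vx π (length π)) (vy π (length π)) b≤h+a) at-end

IsSG⇒Subdiagonal : ∀ {n π} → IsSG n π → Subdiagonal 0 π × width π ≡ n
IsSG⇒Subdiagonal {π = π} (nzs , x-end , y-end , below) =
  coordinates⇒Subdiagonal 0 π (nzs , below , trans x-end (sym y-end)) , trans (sym (vx-length π)) x-end

Subdiagonal⇒IsSG : ∀ {n π} → Subdiagonal 0 π → width π ≡ n → IsSG n π
Subdiagonal⇒IsSG {π = π} π-sub width≡n =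
  let nzs , below , at-end = Subdiagonal⇒coordinates π-sub
      x-end = trans (vx-length π) width≡n
  in nzs , x-end , trans (sym at-end) x-end , below

Hits : ℕ → Path → ℕ → Set
Hits h π u = ∃[ j ] (0 < j × j ≤ length π × h + vx π j ≡ u + vy π j
                     × (∀ l → 0 < l → l ≤ j → u + vy π l ≤ h + vx π l))

HitsFrom : ℕ → Path → ℕ → Set
HitsFrom ℓ π u = ∃[ j ] (j ≤ length π × ℓ + vx π j ≡ u + vy π j
                         × (∀ l → l ≤ j → u + vy π l ≤ ℓ + vx π l))

Hits-∷ : ∀ h a b π u → b ≤ h + a → Hits h ((a , b) ∷ π) u ⇔ HitsFrom (h ▸ (a , b)) π u
Hits-∷ h a b π u b≤h+a = mk⇔
  (λ { (suc j , _ , s≤s j≤ , at-j , above) →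
         j , j≤ , Equivalence.to (shift-≡ h a b u (vx π j) (vy π j) b≤h+a) at-j ,
         λ l l≤j → Equivalence.to (shift-≤ h a b u (vx π l) (vy π l) b≤h+a) (above (suc l) z<s (s≤s l≤j)) })
  (λ { (j , j≤ , at-j , above) →
         suc j , z<s , s≤s j≤ , Equivalence.from (shift-≡ h a b u (vx π j) (vy π j) b≤h+a) at-j ,
         λ { (suc l) _ (s≤s l≤j) →
               Equivalence.from (shift-≤ h a b u (vx π l) (vy π l) b≤h+a) (above l l≤j) } })

HitsFrom⇔ : ∀ ℓ π u → HitsFrom ℓ π u ⇔ (u ≡ ℓ ⊎ (u < ℓ × Hits ℓ π u))
HitsFrom⇔ ℓ π u = mk⇔ to from
  where
  to : HitsFrom ℓ π u → u ≡ ℓ ⊎ (u < ℓ × Hits ℓ π u)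
  to (zero , _ , at-0 , _) = inj₁ (sym (+-cancelʳ-≡ 0 ℓ u at-0))
  to (suc j , j≤ , at-j , above) with m≤n⇒m<n∨m≡n (+-cancelʳ-≤ 0 u ℓ (above 0 z≤n))
  ... | inj₁ u<ℓ = inj₂ (u<ℓ , suc j , z<s , j≤ , at-j , λ l _ → above l)
  ... | inj₂ u≡ℓ = inj₁ u≡ℓ
  from : u ≡ ℓ ⊎ (u < ℓ × Hits ℓ π u) → HitsFrom ℓ π u
  from (inj₁ refl) = zero , z≤n , refl , λ { zero _ → ≤-refl }
  from (inj₂ (u<ℓ , j , _ , j≤ , at-j , above)) =
    j , j≤ , at-j , λ { zero _ → +-monoˡ-≤ 0 (<⇒≤ u<ℓ) ; (suc l) l≤j → above (suc l) z<s l≤j }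

hitsFrom⇔ : ∀ ℓ σ u → hitsFrom ℓ σ u ≡ true ⇔ (u ≡ ℓ ⊎ (u < ℓ × hits ℓ σ u ≡ true))
hitsFrom⇔ ℓ σ u with <-cmp u ℓ
... | tri< u<ℓ u≢ℓ _ =
  mk⇔ (λ hit → inj₂ (u<ℓ , hit)) λ { (inj₁ u≡ℓ) → ⊥-elim (u≢ℓ u≡ℓ) ; (inj₂ (_ , hit)) → hit }
... | tri≈ _ u≡ℓ _ = mk⇔ (λ _ → inj₁ u≡ℓ) (λ _ → refl)
... | tri> _ u≢ℓ u>ℓ =
  mk⇔ (λ ()) λ { (inj₁ u≡ℓ) → ⊥-elim (u≢ℓ u≡ℓ) ; (inj₂ (u<ℓ , _)) → ⊥-elim (<-asym u<ℓ u>ℓ) }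

hits⇔Hits : ∀ {h π} u → Subdiagonal h π → hits h π u ≡ true ⇔ Hits h π u
hits⇔Hits u end = mk⇔ (λ ()) λ { (_ , 0<j , j≤0 , _) → ⊥-elim (<⇒≱ 0<j j≤0) }
hits⇔Hits {h} {(a , b) ∷ π} u (step _ b≤h+a π-sub) =
  ⇔-sym (Hits-∷ h a b π u b≤h+a) ⇔-∘ (⇔-sym (HitsFrom⇔ ℓ π u)
    ⇔-∘ ((⇔-id _ ⊎-⇔ (⇔-id _ ×-⇔ hits⇔Hits u π-sub)) ⇔-∘ hitsFrom⇔ ℓ π u))
  where ℓ = h ▸ (a , b)

ba-interchange : ∀ a b P Q → (b + P) + (a + Q) ≡ (a + b) + (P + Q)
ba-interchange a b P Q = trans (interchange b P a Q) (cong (_+ (P + Q)) (+-comm b a))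

Balanced-∷ : ∀ a b π i j → Balanced ((a , b) ∷ π) (suc i) (suc j) ⇔ Balanced π i j
Balanced-∷ a b π i j = mk⇔
  (λ bal → +-cancelˡ-≡ (a + b) _ _ (trans (sym (interchange a _ b _)) (trans bal (ba-interchange a b _ _))))
  (λ bal → trans (interchange a _ b _) (trans (cong (a + b +_) bal) (sym (ba-interchange a b _ _))))

BelowFrom-∷ : ∀ a b π i l → BelowFrom ((a , b) ∷ π) (suc i) (suc l) ⇔ BelowFrom π i l
BelowFrom-∷ a b π i l = mk⇔
  (λ le → +-cancelˡ-≤ (a + b) _ _ (subst₂ _≤_ (ba-interchange a b _ _) (interchange a _ b _) le))
  (λ le → subst₂ _≤_ (sym (ba-interchange a b _ _)) (sym (interchange a _ b _)) (+-monoʳ-≤ (a + b) le))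

StartsBalSub-∷ : ∀ a b π i → StartsBalSub ((a , b) ∷ π) (suc i) ⇔ StartsBalSub π i
StartsBalSub-∷ a b π i = mk⇔
  (λ { (suc j , s≤s i<j , s≤s j≤ , bal , below) →
         j , i<j , j≤ , Equivalence.to (Balanced-∷ a b π i j) bal ,
         λ l i≤l l≤j → Equivalence.to (BelowFrom-∷ a b π i l) (below (suc l) (s≤s i≤l) (s≤s l≤j)) })
  (λ { (j , i<j , j≤ , bal , below) →
         suc j , s≤s i<j , s≤s j≤ , Equivalence.from (Balanced-∷ a b π i j) bal ,
         λ { (suc l) (s≤s i≤l) (s≤s l≤j) → Equivalence.from (BelowFrom-∷ a b π i l) (below l i≤l l≤j) } })

StartsBalSub-0 : ∀ h π → StartsBalSub π 0 ⇔ Hits h π h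
StartsBalSub-0 h π = mk⇔
  (λ { (j , 0<j , j≤ , bal , below) →
         j , 0<j , j≤ , cong (h +_) (+-cancelʳ-≡ 0 _ _ bal) ,
         λ l _ l≤j → +-monoʳ-≤ h (+-cancelʳ-≤ 0 _ _ (below l z≤n l≤j)) })
  (λ { (j , 0<j , j≤ , at-j , above) →
         j , 0<j , j≤ , cong (_+ 0) (+-cancelˡ-≡ h _ _ at-j) ,
         λ { zero _ _ → z≤n
           ; (suc l) _ l≤j → +-monoˡ-≤ 0 (+-cancelˡ-≤ h _ _ (above (suc l) z<s l≤j)) } })

-- On SG_n the three clauses of Active reduce to this one.
Active⁺ : Path → ℕ → Set
Active⁺ π k = ∃[ i ] (0 < i × i ≤ length π × vx π i ≡ k × StartsBalSub π i)

active⇔Active⁺ : ∀ {h π} k → Subdiagonal h π → active h π k ≡ true ⇔ Active⁺ π k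
active⇔Active⁺ k end = mk⇔ (λ ()) λ { (_ , 0<i , i≤0 , _) → ⊥-elim (<⇒≱ 0<i i≤0) }
active⇔Active⁺ {h} {(a , b) ∷ π} k (step _ b≤h+a π-sub) with <-cmp k a
... | tri< k<a _ _ = mk⇔ (λ ())
  λ { (suc i , _ , _ , x≡k , _) → ⊥-elim (<⇒≱ k<a (subst (a ≤_) x≡k (m≤m+n a (vx π i)))) }
... | tri≈ _ refl _ = mk⇔ to from
  where
  ℓ = h ▸ (k , b)
  to : hits ℓ π ℓ ∨ active ℓ π 0 ≡ true → Active⁺ ((k , b) ∷ π) k
  to hit∨act with hits ℓ π ℓ in hit
  ... | true  = 1 , z<s , s≤s z≤n , +-identityʳ k , Equivalence.from (StartsBalSub-∷ k b π 0)
                  (Equivalence.from (StartsBalSub-0 ℓ π) (Equivalence.to (hits⇔Hits ℓ π-sub) hit))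
  ... | false =
    let i , 0<i , i≤ , x≡0 , sbs = Equivalence.to (active⇔Active⁺ 0 π-sub) hit∨act
    in suc i , z<s , s≤s i≤ , trans (cong (k +_) x≡0) (+-identityʳ k) ,
       Equivalence.from (StartsBalSub-∷ k b π i) sbs
  from : Active⁺ ((k , b) ∷ π) k → hits ℓ π ℓ ∨ active ℓ π 0 ≡ true
  from (suc zero , _ , _ , _ , sbs) =
    cong (_∨ active ℓ π 0) (Equivalence.from (hits⇔Hits ℓ π-sub)
      (Equivalence.to (StartsBalSub-0 ℓ π) (Equivalence.to (StartsBalSub-∷ k b π 0) sbs)))
  from (suc (suc i) , _ , s≤s i≤ , x≡k , sbs) =
    trans (cong (hits ℓ π ℓ ∨_) (Equivalence.from (active⇔Active⁺ 0 π-sub)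
      (suc i , z<s , i≤ , +-cancelˡ-≡ k _ 0 (trans x≡k (sym (+-identityʳ k))) ,
       Equivalence.to (StartsBalSub-∷ k b π (suc i)) sbs)))
      (∨-zeroʳ (hits ℓ π ℓ))
... | tri> _ _ a<k = mk⇔ to from
  where
  ℓ = h ▸ (a , b)
  to : active ℓ π (k ∸ a) ≡ true → Active⁺ ((a , b) ∷ π) k
  to act = let i , 0<i , i≤ , x≡k∸a , sbs = Equivalence.to (active⇔Active⁺ (k ∸ a) π-sub) act
           in suc i , z<s , s≤s i≤ , trans (cong (a +_) x≡k∸a) (m+[n∸m]≡n (<⇒≤ a<k)) ,
              Equivalence.from (StartsBalSub-∷ a b π i) sbs
  from : Active⁺ ((a , b) ∷ π) k → active ℓ π (k ∸ a) ≡ true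
  from (suc zero , _ , _ , a+0≡k , _) = ⊥-elim (<-irrefl (trans (sym (+-identityʳ a)) a+0≡k) a<k)
  from (suc (suc i) , _ , s≤s i≤ , x≡k , sbs) = Equivalence.from (active⇔Active⁺ (k ∸ a) π-sub)
    (suc i , z<s , i≤ , trans (sym (m+n∸m≡n a _)) (cong (_∸ a) x≡k) ,
     Equivalence.to (StartsBalSub-∷ a b π (suc i)) sbs)

Active⇔Active⁺ : ∀ {n π k} → IsSG n π → 0 < k → k < n → Active π k ⇔ Active⁺ π k
Active⇔Active⁺ {n} {π} {k} (_ , x-end , y-end , below) 0<k k<n = mk⇔ to from
  where
  to : Active π k → Active⁺ π k
  to (zero , _ , 0≡k , _) = ⊥-elim (<-irrefl 0≡k 0<k)
  -- A vertex on the diagonal starts the balanced subpath that runs to the end.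
  to (i@(suc _) , i≤ , x≡k , inj₁ diagonal) = i , z<s , i≤ , x≡k ,
    length π , i<length , ≤-refl , cong₂ _+_ (trans x-end (sym y-end)) diagonal ,
    λ l _ l≤ → subst (vy π l + vx π i ≤_) (cong (vx π l +_) (sym diagonal))
                 (+-monoˡ-≤ (vx π i) (below l l≤))
    where
    i<length : i < length π
    i<length = ≤∧≢⇒< i≤ λ i≡length → <-irrefl (trans (sym x≡k) (trans (cong (vx π) i≡length) x-end)) k<n
  to (i@(suc _) , i≤ , x≡k , inj₂ (inj₁ (_ , sbs))) = i , z<s , i≤ , x≡k , sbs
  to (i , i≤ , _ , inj₂ (inj₂ (x<y , _))) = ⊥-elim (<⇒≱ x<y (below i i≤))
  from : Active⁺ π k → Active π k
  from (i , _ , i≤ , x≡k , sbs) with vy π i ≟ vx π i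
  ... | yes diagonal = i , i≤ , x≡k , inj₁ diagonal
  ... | no off       = i , i≤ , x≡k , inj₂ (inj₁ (≤∧≢⇒< (below i i≤) off , sbs))

-- Counting

≡true⇔⇒≡ : ∀ {b c} → (b ≡ true ⇔ c ≡ true) → b ≡ c
≡true⇔⇒≡ {false} {false} _ = refl
≡true⇔⇒≡ {false} {true}  b⇔c = Equivalence.from b⇔c refl
≡true⇔⇒≡ {true}  {_}     b⇔c = sym (Equivalence.to b⇔c refl)

column<n : ∀ n (p : Fin (n ∸ 1)) → suc (toℕ p) < n
column<n (suc n) p = s≤s (toℕ<n p)

active⇔Active : ∀ {n π} (p : Fin (n ∸ 1)) → IsSG n π →
                active 0 π (suc (toℕ p)) ≡ true ⇔ Active π (suc (toℕ p))
active⇔Active {n} p sg =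
  ⇔-sym (Active⇔Active⁺ sg z<s (column<n n p)) ⇔-∘ active⇔Active⁺ _ (proj₁ (IsSG⇒Subdiagonal sg))

ActiveSetIs⇔ : ∀ {n π} S → IsSG n π →
               ActiveSetIs n π S ⇔ (∀ p → active 0 π (suc (toℕ p)) ≡ lookup S p)
ActiveSetIs⇔ S sg = mk⇔
  (λ is p → ≡true⇔⇒≡ (∈⇔lookup p ⇔-∘ (is p ⇔-∘ active⇔Active p sg)))
  (λ is p → ⇔-sym (∈⇔lookup p) ⇔-∘ (≡true⇔ (is p) ⇔-∘ ⇔-sym (active⇔Active p sg)))
  where
  ∈⇔lookup : ∀ p → (p ∈ S) ⇔ (lookup S p ≡ true)
  ∈⇔lookup p = mk⇔ []=⇒lookup (lookup⇒[]= p S)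
  ≡true⇔ : ∀ {b c : Bool} → b ≡ c → (b ≡ true) ⇔ (c ≡ true)
  ≡true⇔ refl = ⇔-id _

Flip : ∀ {m} → Subset m → Subset m → Set
Flip S T = ∃[ p ] (lookup T p ≡ not (lookup S p) × ∀ q → q ≢ p → lookup T q ≡ lookup S q)

Flip-sym : ∀ {m} {S T : Subset m} → Flip S T → Flip T S
Flip-sym {S = S} {T} (p , flipped , others) =
  p , trans (sym (not-involutive (lookup S p))) (cong not (sym flipped)) , λ q q≢p → sym (others q q≢p)

flip-chain : ∀ {m} (S T : Subset m) → Star Flip S T
flip-chain []      []      = ε
flip-chain (x ∷ S) (y ∷ T) = gmap (x ∷_) Flip-∷ (flip-chain S T) ◅◅ flip-head
  where
  Flip-∷ : ∀ {S T} → Flip S T → Flip (x ∷ S) (x ∷ T)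
  Flip-∷ (p , flipped , others) = suc p , flipped ,
    λ { zero _ → refl ; (suc q) sq≢sp → others q (sq≢sp ∘ cong suc) }
  flip-head : Star Flip (x ∷ T) (y ∷ T)
  flip-head with x ≟ᵇ y
  ... | yes refl = ε
  ... | no x≢y   =
    (zero , ¬-not (x≢y ∘ sym) , λ { zero 0≢0 → ⊥-elim (0≢0 refl) ; (suc q) _ → refl }) ◅ ε

SameCount-refl : ∀ {n} S → SameCount n S S
SameCount-refl S = id , id , (λ _ w → w) , (λ _ w → w) , (λ _ _ → refl) , (λ _ _ → refl)

SameCount-trans : ∀ {n S T U} → SameCount n S T → SameCount n T U → SameCount n S U
SameCount-trans (f , g , f∈ , g∈ , gf , fg) (f′ , g′ , f′∈ , g′∈ , g′f′ , f′g′) =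
  f′ ∘ f , g ∘ g′ ,
  (λ π w → f′∈ (f π) (f∈ π w)) ,
  (λ π w → g∈ (g′ π) (g′∈ π w)) ,
  (λ π w → trans (cong g (g′f′ (f π) (f∈ π w))) (gf π w)) ,
  (λ π w → trans (cong f′ (fg (g′ π) (g′∈ π w))) (f′g′ π w))

toggle-WithActive : ∀ {n S T} → ((p , _) : Flip S T) → ∀ π → WithActive n S π →
                    let τ = toggle (suc (toℕ p)) 0 π in WithActive n T τ × toggle (suc (toℕ p)) 0 τ ≡ π
toggle-WithActive {n} {S} {T} (p , flipped , others) π (sg , is-S) =
  (sg′ , Equivalence.from (ActiveSetIs⇔ T sg′) is-T) , involutive
  where
  π-sub = proj₁ (IsSG⇒Subdiagonal sg)
  width≡n = proj₂ (IsSG⇒Subdiagonal sg)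
  k = suc (toℕ p)
  open Toggles (toggles k 0 π π-sub (subst (k <_) (sym width≡n) (column<n n p)) (inj₁ z<s))
  sg′ = Subdiagonal⇒IsSG subdiagonal (trans same-width width≡n)
  is-S′ = Equivalence.to (ActiveSetIs⇔ S sg) is-S
  is-T : ∀ q → active 0 (toggle k 0 π) (suc (toℕ q)) ≡ lookup T q
  is-T q with q ≟ᶠ p
  ... | yes refl = trans flips (trans (cong not (is-S′ q)) (sym flipped))
  ... | no q≢p   = trans (same-active _ (q≢p ∘ toℕ-injective ∘ suc-injective))
                         (trans (is-S′ q) (sym (others q q≢p)))

Flip⇒SameCount : ∀ {n S T} → Flip S T → SameCount n S T
Flip⇒SameCount {n} {S} {T} S↦T@(p , _) =
  f , f , (λ π w → proj₁ (S→T π w)) , (λ π w → proj₁ (T→S π w)) ,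
  (λ π w → proj₂ (S→T π w)) , (λ π w → proj₂ (T→S π w))
  where
  f = toggle (suc (toℕ p)) 0
  S→T = toggle-WithActive {n} {S} {T} S↦T
  T→S = toggle-WithActive {n} {T} {S} (Flip-sym {S = S} {T} S↦T)

theorem2 : (n : ℕ) → 1 ≤ n → (S T : Subset (n ∸ 1)) → SameCount n S T
theorem2 n _ S T = fold (SameCount n) (SameCount-trans ∘ Flip⇒SameCount) (SameCount-refl _) (flip-chain S T)
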